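{- Let $M=(V,D)$ be an even $\Delta$-matroid with $|V|>0$. Then $q_1(M)(-1)=0$.
   Context: A set system is $M=(V,D)$ with $V$ finite, $D$ a family of subsets of $V$; write $Z\in M$ for $Z\in D$; proper means $D\neq\emptyset$. $\oplus$ is symmetric difference; $M*X=(V,\{Z\oplus X:Z\in D\})$. For proper $M$, $d_M(X)=\min\{|X\oplus Z|:Z\in M\}$, $d_M=d_M(\emptyset)$, and $q_1(M)(y)=\sum_{X\subseteq V}y^{d_{M*X}}$. A $\Delta$-matroid is a proper set system such that for all $X,Y\in M$ and $w\in X\oplus Y$, either $X\oplus\{w\}\in M$ or some $v\in X\oplus Y$, $v\neq w$, has $X\oplus\{w,v\}\in M$. A $\Delta$-matroid is even if all its sets have the same parity of cardinality. -}

module Defs where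

open import Data.Bool using (Bool; true; false; _xor_; T)
open import Data.Nat using (ℕ; zero; suc; _⊓_; _%_; _<_)
open import Data.Fin using (Fin)
open import Data.Fin.Subset using (Subset; ∣_∣; _∈_; ⁅_⁆; _∪_)
open import Data.Vec using (Vec; []; _∷_; zipWith)
import Data.Vec
open import Data.List using (List; []; _∷_; map; _++_; foldr; filter)
open import Data.Integer as ℤ using (ℤ)
open import Data.Product using (Σ; _×_; ∃)
open import Data.Sum using (_⊎_)
open import Relation.Binary.PropositionalEquality using (_≡_; _≢_)
open import Relation.Nullary.Decidable using (Dec)

record SetSystem (n : ℕ) : Set where
  constructor mkSetSystem
  field
    D : Subset n → Bool

open SetSystem public

_∈M_ : {n : ℕ} → Subset n → SetSystem n → Set
Z ∈M M = D M Z ≡ true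

_⊕_ : {n : ℕ} → Subset n → Subset n → Subset n
X ⊕ Y = zipWith _xor_ X Y

_*ˢ_ : {n : ℕ} → SetSystem n → Subset n → SetSystem n
M *ˢ X = mkSetSystem (λ Z → D M (Z ⊕ X))

Proper : {n : ℕ} → SetSystem n → Set
Proper M = ∃ λ Z → Z ∈M M

allSubsets : (n : ℕ) → List (Subset n)
allSubsets zero = [] ∷ []
allSubsets (suc n) = map (true ∷_) (allSubsets n) ++ map (false ∷_) (allSubsets n)

members : {n : ℕ} → SetSystem n → List (Subset n)
members {n} M = filter (λ Z → T? (D M Z)) (allSubsets n)
  where
  open import Relation.Nullary.Decidable using () renaming (T? to T?)

-- d_M(X) = min { |X ⊕ Z| : Z ∈ M }.  (Only meaningful for proper M; the fold
-- starts at n, which is an upper bound for every |X ⊕ Z|, so for proper M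
-- this is exactly the minimum.)
dist : {n : ℕ} → SetSystem n → Subset n → ℕ
dist {n} M X = foldr (λ Z m → ∣ X ⊕ Z ∣ ⊓ m) n (members M)

dist∅ : {n : ℕ} → SetSystem n → ℕ
dist∅ {n} M = dist M (Data.Vec.replicate n false)

-- q_1(M) evaluated at an integer y:  Σ_{X ⊆ V} y ^ d_{M*X}
sumℤ : List ℤ → ℤ
sumℤ = foldr ℤ._+_ (ℤ.+ 0)

q₁ : {n : ℕ} → SetSystem n → ℤ → ℤ
q₁ {n} M y = sumℤ (map (λ X → y ℤ.^ dist∅ (M *ˢ X)) (allSubsets n))

IsΔMatroid : {n : ℕ} → SetSystem n → Set
IsΔMatroid {n} M =
  Proper M ×
  ((X Y : Subset n) → X ∈M M → Y ∈M M → (w : Fin n) → w ∈ (X ⊕ Y) →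
     ((X ⊕ ⁅ w ⁆) ∈M M) ⊎
     (Σ (Fin n) λ v → v ∈ (X ⊕ Y) × v ≢ w × ((X ⊕ (⁅ w ⁆ ∪ ⁅ v ⁆)) ∈M M)))

IsEven : {n : ℕ} → SetSystem n → Set
IsEven {n} M = (X Y : Subset n) → X ∈M M → Y ∈M M → ∣ X ∣ % 2 ≡ ∣ Y ∣ % 2

-- For Z ∈ M the set Z ⊕ X lies in M * X, so M * X is proper, and all its members
-- have the parity of |Z₀| + |X| for a fixed Z₀ ∈ M because M is even.  The distance
-- d_{M*X} is the size of one of them, hence (-1)^{d_{M*X}} = (-1)^{|Z₀|} (-1)^{|X|}
-- and q₁(M)(-1) = (-1)^{|Z₀|} Σ_{X ⊆ V} (-1)^{|X|} = 0 as V ≠ ∅.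

module Submission where

open import Defs
open import Data.Nat using (ℕ; _<_)
open import Data.Integer using (ℤ; -[1+_]; +_)
open import Relation.Binary.PropositionalEquality using (_≡_)

open import Data.Bool using (true; false)
open import Data.Bool.Properties using (T-≡; xor-same; xor-identityˡ; xor-identityʳ; xor-assoc)
open import Function.Bundles using (Equivalence)
open import Data.Nat using (zero; suc; _⊓_; _%_; _≤_)
open import Data.Nat.Properties using (⊓-sel; m⊓n≤m; m⊓n≤n; ≤-trans; ≤-antisym; ≤-reflexive)
open import Data.Integer using (_+_; _*_; -_; _^_; -1ℤ; 0ℤ)
open import Data.Integer.Properties using (-1*i≡-i; neg-involutive; +-identityˡ; +-assoc; +-inverseˡ; *-distribˡ-+; *-zeroʳ)
open import Data.Integer.Tactic.RingSolver using (solve-∀)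
open import Data.Vec using ([]; _∷_)
open import Data.Vec.Properties using (zipWith-assoc; zipWith-identityˡ; zipWith-identityʳ)
open import Data.Fin.Subset using (Subset; ∣_∣; ⊥)
open import Data.Fin.Subset.Properties using (∣p∣≤n)
open import Data.List using (List; []; _∷_; map; _++_; foldr)
open import Data.List.Properties using (map-++; map-∘; map-cong)
open import Data.List.Relation.Unary.Any using (here; there)
open import Data.List.Membership.Propositional using (_∈_)
open import Data.List.Membership.Propositional.Properties using (∈-map⁺; ∈-++⁺ˡ; ∈-++⁺ʳ; ∈-filter⁻; ∈-filter⁺)
open import Data.Product using (_,_; proj₂; _×_; ∃)
open import Data.Sum using (_⊎_; inj₁; inj₂)
open import Relation.Binary.PropositionalEquality using (refl; sym; trans; cong; cong₂; module ≡-Reasoning)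
open import Relation.Nullary.Decidable using (T?)

open ≡-Reasoning

module _ {A : Set} (f : A → ℕ) (b : ℕ) where

  foldr-⊓ : List A → ℕ
  foldr-⊓ = foldr (λ x m → f x ⊓ m) b

  foldr-⊓-sel : ∀ xs → foldr-⊓ xs ≡ b ⊎ ∃ λ x → x ∈ xs × foldr-⊓ xs ≡ f x
  foldr-⊓-sel [] = inj₁ refl
  foldr-⊓-sel (y ∷ xs) with ⊓-sel (f y) (foldr-⊓ xs) | foldr-⊓-sel xs
  ... | inj₁ e | _                    = inj₂ (y , here refl , e)
  ... | inj₂ e | inj₁ e′              = inj₁ (trans e e′)
  ... | inj₂ e | inj₂ (x , x∈ , e′)   = inj₂ (x , there x∈ , trans e e′)

  foldr-⊓≤ : ∀ {x} xs → x ∈ xs → foldr-⊓ xs ≤ f x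
  foldr-⊓≤ (y ∷ xs) (here refl) = m⊓n≤m (f y) (foldr-⊓ xs)
  foldr-⊓≤ (y ∷ xs) (there x∈)  = ≤-trans (m⊓n≤n (f y) (foldr-⊓ xs)) (foldr-⊓≤ xs x∈)

  foldr-⊓-attained : ∀ {x} xs → x ∈ xs → f x ≤ b → ∃ λ y → y ∈ xs × foldr-⊓ xs ≡ f y
  foldr-⊓-attained {x} xs x∈ fx≤b with foldr-⊓-sel xs
  ... | inj₂ attained = attained
  ... | inj₁ e = x , x∈ , ≤-antisym (foldr-⊓≤ xs x∈) (≤-trans fx≤b (≤-reflexive (sym e)))

⊕-self : ∀ {n} (A : Subset n) → A ⊕ A ≡ ⊥
⊕-self []      = refl
⊕-self (a ∷ A) = cong₂ _∷_ (xor-same a) (⊕-self A)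

⊥-⊕ : ∀ {n} (A : Subset n) → ⊥ ⊕ A ≡ A
⊥-⊕ = zipWith-identityˡ xor-identityˡ

⊕-cancelʳ : ∀ {n} (A B : Subset n) → (A ⊕ B) ⊕ B ≡ A
⊕-cancelʳ A B = begin
  (A ⊕ B) ⊕ B  ≡⟨ zipWith-assoc xor-assoc A B B ⟩
  A ⊕ (B ⊕ B)  ≡⟨ cong (A ⊕_) (⊕-self B) ⟩
  A ⊕ ⊥        ≡⟨ zipWith-identityʳ xor-identityʳ A ⟩
  A            ∎

-1^∣⊕∣ : ∀ {n} (A B : Subset n) → -1ℤ ^ ∣ A ⊕ B ∣ ≡ -1ℤ ^ ∣ A ∣ * -1ℤ ^ ∣ B ∣
-1^∣⊕∣ []          []          = refl
-1^∣⊕∣ (true ∷ A)  (true ∷ B)  = trans (-1^∣⊕∣ A B) (regroup (-1ℤ ^ ∣ A ∣) (-1ℤ ^ ∣ B ∣))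
  where regroup : ∀ a b → a * b ≡ (-1ℤ * a) * (-1ℤ * b)
        regroup = solve-∀
-1^∣⊕∣ (true ∷ A)  (false ∷ B) = trans (cong (-1ℤ *_) (-1^∣⊕∣ A B)) (regroup (-1ℤ ^ ∣ A ∣) (-1ℤ ^ ∣ B ∣))
  where regroup : ∀ a b → -1ℤ * (a * b) ≡ (-1ℤ * a) * b
        regroup = solve-∀
-1^∣⊕∣ (false ∷ A) (true ∷ B)  = trans (cong (-1ℤ *_) (-1^∣⊕∣ A B)) (regroup (-1ℤ ^ ∣ A ∣) (-1ℤ ^ ∣ B ∣))
  where regroup : ∀ a b → -1ℤ * (a * b) ≡ a * (-1ℤ * b)
        regroup = solve-∀
-1^∣⊕∣ (false ∷ A) (false ∷ B) = -1^∣⊕∣ A B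

-1^-%2 : ∀ m → -1ℤ ^ m ≡ -1ℤ ^ (m % 2)
-1^-%2 zero          = refl
-1^-%2 (suc zero)    = refl
-1^-%2 (suc (suc m)) = begin
  -1ℤ * (-1ℤ * -1ℤ ^ m)  ≡⟨ -1*i≡-i _ ⟩
  - (-1ℤ * -1ℤ ^ m)      ≡⟨ cong -_ (-1*i≡-i _) ⟩
  - - (-1ℤ ^ m)          ≡⟨ neg-involutive _ ⟩
  -1ℤ ^ m                ≡⟨ -1^-%2 m ⟩
  -1ℤ ^ (m % 2)          ∎

-1^-cong-%2 : ∀ m n → m % 2 ≡ n % 2 → -1ℤ ^ m ≡ -1ℤ ^ n
-1^-cong-%2 m n e = trans (-1^-%2 m) (trans (cong (-1ℤ ^_) e) (sym (-1^-%2 n)))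

∈-allSubsets : ∀ {n} (A : Subset n) → A ∈ allSubsets n
∈-allSubsets []                = here refl
∈-allSubsets {suc n} (true ∷ A)  = ∈-++⁺ˡ (∈-map⁺ (true ∷_) (∈-allSubsets A))
∈-allSubsets {suc n} (false ∷ A) =
  ∈-++⁺ʳ (map (true ∷_) (allSubsets n)) (∈-map⁺ (false ∷_) (∈-allSubsets A))

module _ {n : ℕ} (M : SetSystem n) where

  ∈-members⁺ : ∀ {Z} → Z ∈M M → Z ∈ members M
  ∈-members⁺ {Z} Z∈M = ∈-filter⁺ (λ Z → T? (D M Z)) (∈-allSubsets Z) (Equivalence.from T-≡ Z∈M)

  ∈-members⁻ : ∀ {Z} → Z ∈ members M → Z ∈M M
  ∈-members⁻ Z∈ = Equivalence.to T-≡ (proj₂ (∈-filter⁻ (λ Z → T? (D M Z)) {xs = allSubsets n} Z∈))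

  dist-attained : Proper M → (X : Subset n) → ∃ λ Z → Z ∈M M × dist M X ≡ ∣ X ⊕ Z ∣
  dist-attained (Z₀ , Z₀∈M) X
    with foldr-⊓-attained (λ Z → ∣ X ⊕ Z ∣) n (members M) (∈-members⁺ Z₀∈M) (∣p∣≤n (X ⊕ Z₀))
  ... | Z , Z∈ , e = Z , ∈-members⁻ Z∈ , e

  dist∅-attained : Proper M → ∃ λ Z → Z ∈M M × dist∅ M ≡ ∣ Z ∣
  dist∅-attained proper with dist-attained proper ⊥
  ... | Z , Z∈M , e = Z , Z∈M , trans e (cong ∣_∣ (⊥-⊕ Z))

*ˢ-proper : ∀ {n} (M : SetSystem n) → Proper M → (X : Subset n) → Proper (M *ˢ X)
*ˢ-proper M (Z , Z∈M) X = Z ⊕ X , trans (cong (D M) (⊕-cancelʳ Z X)) Z∈M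

-1^dist∅-*ˢ : ∀ {n} (M : SetSystem n) → IsEven M → ∀ {Z₀} → Z₀ ∈M M → (X : Subset n) →
  -1ℤ ^ dist∅ (M *ˢ X) ≡ -1ℤ ^ ∣ Z₀ ∣ * -1ℤ ^ ∣ X ∣
-1^dist∅-*ˢ M even {Z₀} Z₀∈M X with dist∅-attained (M *ˢ X) (*ˢ-proper M (Z₀ , Z₀∈M) X)
... | Z , Z⊕X∈M , e = begin
  -1ℤ ^ dist∅ (M *ˢ X)
    ≡⟨ cong (-1ℤ ^_) e ⟩
  -1ℤ ^ ∣ Z ∣
    ≡⟨ cong (λ A → -1ℤ ^ ∣ A ∣) (⊕-cancelʳ Z X) ⟨
  -1ℤ ^ ∣ (Z ⊕ X) ⊕ X ∣
    ≡⟨ -1^∣⊕∣ (Z ⊕ X) X ⟩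
  -1ℤ ^ ∣ Z ⊕ X ∣ * -1ℤ ^ ∣ X ∣
    ≡⟨ cong (_* -1ℤ ^ ∣ X ∣) (-1^-cong-%2 ∣ Z ⊕ X ∣ ∣ Z₀ ∣ (even _ _ Z⊕X∈M Z₀∈M)) ⟩
  -1ℤ ^ ∣ Z₀ ∣ * -1ℤ ^ ∣ X ∣
    ∎

sumℤ-++ : ∀ xs ys → sumℤ (xs ++ ys) ≡ sumℤ xs + sumℤ ys
sumℤ-++ []       ys = sym (+-identityˡ (sumℤ ys))
sumℤ-++ (x ∷ xs) ys = trans (cong (_+_ x) (sumℤ-++ xs ys)) (sym (+-assoc x (sumℤ xs) (sumℤ ys)))

sumℤ-map-* : ∀ {A : Set} (c : ℤ) (f : A → ℤ) xs →
  sumℤ (map (λ x → c * f x) xs) ≡ c * sumℤ (map f xs)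
sumℤ-map-* c f []       = sym (*-zeroʳ c)
sumℤ-map-* c f (x ∷ xs) =
  trans (cong (_+_ (c * f x)) (sumℤ-map-* c f xs)) (sym (*-distribˡ-+ c (f x) (sumℤ (map f xs))))

sumℤ-alternating : ∀ n → sumℤ (map (λ X → -1ℤ ^ ∣ X ∣) (allSubsets (suc n))) ≡ 0ℤ
sumℤ-alternating n = begin
  sumℤ (map sign (map (true ∷_) A ++ map (false ∷_) A))
    ≡⟨ cong sumℤ (map-++ sign (map (true ∷_) A) (map (false ∷_) A)) ⟩
  sumℤ (map sign (map (true ∷_) A) ++ map sign (map (false ∷_) A))
    ≡⟨ sumℤ-++ (map sign (map (true ∷_) A)) (map sign (map (false ∷_) A)) ⟩
  sumℤ (map sign (map (true ∷_) A)) + sumℤ (map sign (map (false ∷_) A))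
    ≡⟨ cong₂ (λ xs ys → sumℤ xs + sumℤ ys) (map-∘ A) (map-∘ A) ⟨
  sumℤ (map (λ Y → -1ℤ * sign Y) A) + S
    ≡⟨ cong (_+ S) (trans (sumℤ-map-* -1ℤ sign A) (-1*i≡-i S)) ⟩
  - S + S
    ≡⟨ +-inverseˡ S ⟩
  0ℤ ∎
  where
  A : List (Subset n)
  A = allSubsets n
  sign : ∀ {k} → Subset k → ℤ
  sign X = -1ℤ ^ ∣ X ∣
  S : ℤ
  S = sumℤ (map sign A)

theorem24 : (n : ℕ) → 0 < n → (M : SetSystem n) → IsΔMatroid M → IsEven M →
    q₁ M -[1+ 0 ] ≡ + 0
theorem24 (suc n) _ M ((Z₀ , Z₀∈M) , _) even = begin
  sumℤ (map (λ X → -1ℤ ^ dist∅ (M *ˢ X)) Subsets)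
    ≡⟨ cong sumℤ (map-cong (-1^dist∅-*ˢ M even Z₀∈M) Subsets) ⟩
  sumℤ (map (λ X → -1ℤ ^ ∣ Z₀ ∣ * -1ℤ ^ ∣ X ∣) Subsets)
    ≡⟨ sumℤ-map-* (-1ℤ ^ ∣ Z₀ ∣) (λ X → -1ℤ ^ ∣ X ∣) Subsets ⟩
  -1ℤ ^ ∣ Z₀ ∣ * sumℤ (map (λ X → -1ℤ ^ ∣ X ∣) Subsets)
    ≡⟨ cong (-1ℤ ^ ∣ Z₀ ∣ *_) (sumℤ-alternating n) ⟩
  -1ℤ ^ ∣ Z₀ ∣ * 0ℤ
    ≡⟨ *-zeroʳ (-1ℤ ^ ∣ Z₀ ∣) ⟩
  0ℤ ∎
  where
  Subsets : List (Subset (suc n))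
  Subsets = allSubsets (suc n)
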